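{- Let $G$ be a finite simple graph. Then $G$ is probe diamond-free if and only if all of the following hold: (i) $G$ is locally union of complete split (LUCS); (ii) $G$ is $\overline{P_3+K_2}$-free; (iii) the set $N_G$ is an independent set of $G$; and (iv) the auxiliary bipartite graph $G_B$ contains no induced cycle of length $6$.
   Context: A diamond is $K_4$ minus one edge; its tips are the two nonadjacent vertices. A graph $G=(V,E)$ is probe diamond-free if $V$ admits a partition $V=P\cup N$ with $N$ an independent set, and there is a set $F$ of non-edges of $G$ with both endpoints in $N$ such that $(V,E\cup F)$ has no induced diamond. A graph is $H$-free if it has no induced subgraph isomorphic to $H$; $\overline{H}$ is the complement and $+$ is disjoint union. A graph is complete split if its vertex set can be partitioned into a clique $K$ and a maximum independent set $S$ with every vertex of $K$ adjacent to every vertex of $S$; $(K,S)$ is a complete split partition (unique when the graph is connected and $|S|\ge 2$). $G$ is LUCS if for every vertex $v$, every connected component of $G[N(v)]$ is complete split. For a LUCS graph, for a vertex $w$ and a connected component $C_w$ of $G[N(w)]$ with complete split partition $(K_{C_w},S_{C_w})$, call $C_w$ non-special if $|S_{C_w}|\ge 2$. $F_G$ is the set of non-edges $uv$ with $u,v\in S_{C_w}$ for some vertex $w$ and some component $C_w$ of $G[N(w)]$, and $N_G$ is the set of endpoints of pairs in $F_G$. Given a bijection $\phi:V(G)\to\{0,\dots,|V(G)|-1\}$, the bipartite graph $G_B$ has one side $N_G$ and the other side $A_B$, where for each vertex $v$ and each non-special component $C_v$ of $G[N(v)]$ with $\phi(v)<\phi(x)$ for all $x\in K_{C_v}$ one adds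 a new vertex to $A_B$ adjacent exactly to the vertices of $S_{C_v}$; up to isomorphism $G_B$ does not depend on $\phi$. -}

module Defs where

open import Data.Nat using (ℕ; _≤_; _%_; _+_)
open import Data.Fin using (Fin; toℕ)
import Data.Fin as F
open import Data.Fin.Subset using (Subset; _∈_; _∉_; _⊆_; ∣_∣)
open import Data.Fin.Permutation using (Permutation′; _⟨$⟩ʳ_)
open import Data.Bool using (Bool; true; false)
open import Data.Product using (Σ; ∃; ∃-syntax; _×_; _,_)
open import Data.Sum using (_⊎_; inj₁; inj₂)
open import Data.Empty using (⊥)
open import Relation.Nullary using (¬_)
open import Relation.Binary.PropositionalEquality using (_≡_; _≢_)

record Graph (n : ℕ) : Set where
  field
    adj    : Fin n → Fin n → Bool
    sym    : ∀ u v → adj u v ≡ adj v u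
    irrefl : ∀ v → adj v v ≡ false

open Graph public

module _ {n : ℕ} (G : Graph n) where

  E : Fin n → Fin n → Set
  E u v = adj G u v ≡ true

  -- an induced diamond (K4 minus the edge a d; a and d are the tips)
  -- given by an arbitrary symmetric adjacency relation R
  InducedDiamondIn : (Fin n → Fin n → Set) → Set
  InducedDiamondIn R = ∃[ a ] ∃[ b ] ∃[ c ] ∃[ d ]
    (a ≢ d × ¬ R a d ×
     R a b × R a c × R b c × R b d × R c d)

  -- an induced copy of the complement of P3 + K2, where the P3 is
  -- a - b - c and the K2 is d - e.  Its edges are all pairs except
  -- ab, bc, de.
  InducedCoP3K2 : Set
  InducedCoP3K2 = ∃[ a ] ∃[ b ] ∃[ c ] ∃[ d ] ∃[ e ]
    (a ≢ b × b ≢ c × d ≢ e ×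
     ¬ E a b × ¬ E b c × ¬ E d e ×
     E a c × E a d × E a e × E b d × E b e × E c d × E c e)

  CoP3K2-free : Set
  CoP3K2-free = ¬ InducedCoP3K2

  Independent : Subset n → Set
  Independent X = ∀ u v → u ∈ X → v ∈ X → ¬ E u v

  ValidFill : Subset n → (Fin n → Fin n → Bool) → Set
  ValidFill N Fl = ∀ u v → Fl u v ≡ true →
    u ∈ N × v ∈ N × u ≢ v × ¬ E u v

  EFill : (Fin n → Fin n → Bool) → Fin n → Fin n → Set
  EFill Fl u v = E u v ⊎ Fl u v ≡ true ⊎ Fl v u ≡ true

  -- V = P ∪ N with N independent (P is the complement of N)
  ProbeDiamondFree : Set
  ProbeDiamondFree = ∃[ N ] (Independent N ×
    ∃[ Fl ] (ValidFill N Fl × ¬ InducedDiamondIn (EFill Fl)))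

  data ReachIn (X : Fin n → Set) : Fin n → Fin n → Set where
    here : ∀ {u} → X u → ReachIn X u u
    step : ∀ {u w z} → X u → E u w → ReachIn X w z → ReachIn X u z

  IsComponent : Fin n → Subset n → Set
  IsComponent v C =
    (∃[ u ] u ∈ C) ×
    (∀ u → u ∈ C → E v u) ×
    (∀ u w → u ∈ C →
       (w ∈ C → ReachIn (E v) u w) × (ReachIn (E v) u w → w ∈ C))

  IsCSPartition : Subset n → Subset n → Subset n → Set
  IsCSPartition C K S =
    (∀ x → x ∈ C → x ∈ K ⊎ x ∈ S) ×
    (∀ x → x ∈ K → x ∈ C) ×
    (∀ x → x ∈ S → x ∈ C) ×
    (∀ x → x ∈ K → x ∉ S) ×
    (∀ x y → x ∈ K → y ∈ K → x ≢ y → E x y) ×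
    Independent S ×
    (∀ T → T ⊆ C → Independent T → ∣ T ∣ ≤ ∣ S ∣) ×
    (∀ x y → x ∈ K → y ∈ S → E x y)

  IsCompleteSplit : Subset n → Set
  IsCompleteSplit C = ∃[ K ] ∃[ S ] IsCSPartition C K S

  LUCS : Set
  LUCS = ∀ v C → IsComponent v C → IsCompleteSplit C

  FG : Fin n → Fin n → Set
  FG u v = u ≢ v × ¬ E u v ×
    ∃[ w ] ∃[ C ] (IsComponent w C ×
      ∃[ K ] ∃[ S ] (IsCSPartition C K S × u ∈ S × v ∈ S))

  InNG : Fin n → Set
  InNG u = ∃[ v ] FG u v

  NG-independent : Set
  NG-independent = ∀ u v → InNG u → InNG v → ¬ E u v

  -- The bipartite graph G_B (w.r.t. a bijection φ : V → {0,…,n-1})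
  -- Vertices: inj₁ u for u ∈ N_G, and inj₂ (v , C) for each vertex v
  -- and qualifying component C of G[N(v)].

  VB : Set
  VB = Fin n ⊎ (Fin n × Subset n)

  InGB : Permutation′ n → VB → Set
  InGB φ (inj₁ u) = InNG u
  InGB φ (inj₂ (v , C)) = IsComponent v C ×
    ∃[ K ] ∃[ S ] (IsCSPartition C K S × 2 ≤ ∣ S ∣ ×
      (∀ x → x ∈ K → (φ ⟨$⟩ʳ v) F.< (φ ⟨$⟩ʳ x)))

  AdjB′ : VB → VB → Set
  AdjB′ (inj₁ u) (inj₂ (v , C)) = ∃[ K ] ∃[ S ] (IsCSPartition C K S × u ∈ S)
  AdjB′ _ _ = ⊥

  AdjB : VB → VB → Set
  AdjB x y = AdjB′ x y ⊎ AdjB′ y x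

C6adj : Fin 6 → Fin 6 → Set
C6adj i j = (toℕ i + 1) % 6 ≡ toℕ j ⊎ (toℕ j + 1) % 6 ≡ toℕ i

HasInducedC6 : {V : Set} → (V → Set) → (V → V → Set) → Set
HasInducedC6 {V} Vert R = Σ (Fin 6 → V) λ f →
  (∀ i → Vert (f i)) ×
  (∀ i j → f i ≡ f j → i ≡ j) ×
  (∀ i j → (R (f i) (f j) → C6adj i j) × (C6adj i j → R (f i) (f j)))

GB-C6-free : {n : ℕ} → Graph n → Permutation′ n → Set
GB-C6-free G φ = ¬ HasInducedC6 (InGB G φ) (AdjB G)

{-# OPTIONS --safe #-}
-- Necessity.  Let H = E ∪ F be diamond-free.  Closing diamonds along a walk shows that
-- every component of G[N(v)] is an H-clique; as H-edges outside E join vertices of the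
-- independent set N, such a component splits into its N-part and a clique complete to
-- it, so G is LUCS.  Closing diamonds also puts N_G inside N and excludes the
-- complement of P₃ + K₂.  Finally an N_G-vertex that is H-adjacent to two N_G-vertices
-- of a block of G_B lies in that block, and an induced C₆ of G_B violates exactly this.
--
-- Sufficiency.  Let N be the set of tips of induced diamonds of G and F the pairs of
-- tips of a common diamond.  By LUCS tips belong to N_G, hence are pairwise non-adjacent; the
-- common neighbours of two tips form a clique, since otherwise the complement of
-- P₃ + K₂ appears; and three pairwise tip pairs have an edge in their common
-- neighbourhood, since otherwise the three blocks at their φ-least common neighbours
-- form an induced C₆ in G_B.  With these facts, a case split on which vertices of a
-- diamond of E ∪ F are tips shows that its two tips are adjacent or tips of a diamond
-- of G, i.e. adjacent in E ∪ F.

module Submission where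

open import Defs
open import Data.Nat using (ℕ)
open import Data.Product using (_×_)
open import Data.Fin.Permutation using (Permutation′)

open import Data.Bool using (Bool; true)
import Data.Bool.Properties as Bool
open import Data.Empty using (⊥; ⊥-elim)
open import Data.Fin as Fin using (Fin; toℕ; _≟_)
open import Data.Fin.Patterns
open import Data.Fin.Permutation using (_⟨$⟩ʳ_; _⟨$⟩ˡ_; inverseˡ)
open import Data.Fin.Properties using (all?; any?; ∀-cons; toℕ-injective)
open import Data.Fin.Subset using (Subset; _∈_; _∉_; _⊆_; ⁅_⁆; ∣_∣; Nonempty; _∩_; ∁)
open import Data.Fin.Subset.Properties
  using ( _∈?_; nonempty?; Empty-unique; p⊆q⇒∣p∣≤∣q∣; ∣⊥∣≡0; ∣⁅x⁆∣≡1; x∈⁅x⁆; x∈⁅y⁆⇒x≡y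
        ; x∈p⇒∣p-x∣<∣p∣; x∈p∧x≢y⇒x∈p-y; x∈p∩q⁺; x∈p∩q⁻; x∉p⇒x∈∁p; x∈∁p⇒x∉p )
open import Data.List using (filter; allFin)
open import Data.List.Extrema.Nat using (argmin; argmin-all; f[argmin]≤f[xs])
open import Data.List.Membership.Propositional.Properties using (∈-filter⁺; ∈-allFin)
open import Data.List.Relation.Unary.All using () renaming (lookup to lookupᴬ)
open import Data.List.Relation.Unary.All.Properties using (all-filter)
open import Data.Nat as ℕ using (zero; suc; _≤_; _<_; z≤n; s≤s)
import Data.Nat.Properties as ℕ
open import Data.Product using (∃; ∃-syntax; _,_; proj₁; proj₂)
open import Data.Sum using (_⊎_; inj₁; inj₂; [_,_]′; swap)
open import Data.Vec using (tabulate)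
open import Data.Vec.Properties using (lookup∘tabulate; []=⇒lookup; lookup⇒[]=)
open import Function using (_∘_)
open import Level using (0ℓ)
open import Relation.Nullary using (¬_; Dec; does; yes; no)
open import Relation.Nullary.Decidable
  using ( ¬¬-excluded-middle; decidable-stable; dec-true; from-yes
        ; _×-dec_; _⊎-dec_; _→-dec_; ¬? )
open import Relation.Nullary.Negation using (¬¬-map)
open import Relation.Unary using (Pred; Decidable)
open import Relation.Binary.PropositionalEquality as ≡
  using (_≡_; _≢_; refl; trans; subst; cong)

private
  variable
    n : ℕ

does≡true⇒ : {A : Set} (a? : Dec A) → does a? ≡ true → A
does≡true⇒ (yes a) _ = a
does≡true⇒ (no _)  ()

module _ {P : Pred (Fin n) 0ℓ} (P? : Decidable P) where

  ⟦_⟧ : Subset n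
  ⟦_⟧ = tabulate (does ∘ P?)

  ∈⟦⟧⁺ : ∀ {x} → P x → x ∈ ⟦_⟧
  ∈⟦⟧⁺ {x} px = lookup⇒[]= x ⟦_⟧ (trans (lookup∘tabulate (does ∘ P?) x) (dec-true (P? x) px))

  ∈⟦⟧⁻ : ∀ {x} → x ∈ ⟦_⟧ → P x
  ∈⟦⟧⁻ {x} x∈ = does≡true⇒ (P? x) (trans (≡.sym (lookup∘tabulate (does ∘ P?) x)) ([]=⇒lookup x∈))

¬¬-decidable : (P : Pred (Fin n) 0ℓ) → ¬ ¬ Decidable P
¬¬-decidable {zero} P k = k λ ()
¬¬-decidable {suc n} P k =
  ¬¬-excluded-middle λ P0? → ¬¬-decidable (P ∘ Fin.suc) λ P+? → k (∀-cons P0? P+?)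

least : {P : Pred (Fin n) 0ℓ} → Decidable P → (rank : Fin n → ℕ) → ∃ P →
        ∃[ z ] (P z × ∀ {y} → P y → rank z ≤ rank y)
least {n} P? rank (x , px) =
  argmin rank x xs ,
  argmin-all rank px (all-filter P? (allFin n)) ,
  λ {y} py → lookupᴬ (f[argmin]≤f[xs] x xs) (∈-filter⁺ P? (∈-allFin y) py)
  where xs = filter P? (allFin n)

subsingleton⇒∣p∣≤1 : {p : Subset n} → (∀ {x y} → x ∈ p → y ∈ p → x ≡ y) → ∣ p ∣ ≤ 1
subsingleton⇒∣p∣≤1 {n} {p} unique with nonempty? p
... | yes (x , x∈p) =
  subst (∣ p ∣ ≤_) (∣⁅x⁆∣≡1 x) (p⊆q⇒∣p∣≤∣q∣ λ y∈p → subst (_∈ ⁅ x ⁆) (unique x∈p y∈p) (x∈⁅x⁆ x))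
... | no empty = subst (_≤ 1) (≡.sym (trans (cong ∣_∣ (Empty-unique empty)) (∣⊥∣≡0 n))) z≤n

x∈p⇒0<∣p∣ : {p : Subset n} {x : Fin n} → x ∈ p → 0 < ∣ p ∣
x∈p⇒0<∣p∣ x∈p = ℕ.≤-<-trans z≤n (x∈p⇒∣p-x∣<∣p∣ x∈p)

x∈p∧y∈p∧x≢y⇒2≤∣p∣ : {p : Subset n} {x y : Fin n} → x ∈ p → y ∈ p → x ≢ y → 2 ≤ ∣ p ∣
x∈p∧y∈p∧x≢y⇒2≤∣p∣ x∈p y∈p x≢y =
  ℕ.≤-trans (s≤s (x∈p⇒0<∣p∣ (x∈p∧x≢y⇒x∈p-y y∈p (x≢y ∘ ≡.sym)))) (x∈p⇒∣p-x∣<∣p∣ x∈p)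

next : Fin 6 → Fin 6
next 0F = 1F
next 1F = 2F
next 2F = 3F
next 3F = 4F
next 4F = 5F
next 5F = 0F

C6adj? : ∀ i j → Dec (C6adj i j)
C6adj? i j = ((toℕ i ℕ.+ 1) ℕ.% 6 ℕ.≟ toℕ j) ⊎-dec ((toℕ j ℕ.+ 1) ℕ.% 6 ℕ.≟ toℕ i)

C6adj-next : ∀ i → C6adj i (next i)
C6adj-next = from-yes (all? λ i → C6adj? i (next i))

C6adj⇒next : ∀ i j → C6adj i j → j ≡ next i ⊎ i ≡ next j
C6adj⇒next = from-yes (all? λ i → all? λ j → C6adj? i j →-dec (j ≟ next i ⊎-dec i ≟ next j))

¬C6adj⇒ : ∀ i j → ¬ C6adj i j →
          j ≡ i ⊎ j ≡ next (next i) ⊎ i ≡ next (next j) ⊎ j ≡ next (next (next i))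
¬C6adj⇒ = from-yes (all? λ i → all? λ j → ¬? (C6adj? i j) →-dec
  (j ≟ i ⊎-dec j ≟ next (next i) ⊎-dec i ≟ next (next j) ⊎-dec j ≟ next (next (next i))))

next²-≢ : ∀ i → i ≢ next (next i)
next²-≢ = from-yes (all? λ i → ¬? (i ≟ next (next i)))

¬C6adj-next³ : ∀ i → ¬ C6adj i (next (next (next i)))
¬C6adj-next³ = from-yes (all? λ i → ¬? (C6adj? i (next (next (next i)))))

C6adj-extensional : ∀ i j → (∀ k → C6adj i k → C6adj j k) → i ≡ j
C6adj-extensional =
  from-yes (all? λ i → all? λ j → all? (λ k → C6adj? i k →-dec C6adj? j k) →-dec i ≟ j)

module _ {V : Set} {Vert : V → Set} {R : V → V → Set}
         (R-sym : ∀ {x y} → R x y → R y x) (R-irrefl : ∀ {x} → ¬ R x x)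
         (x : Fin 6 → V)
         (edge : ∀ i → R (x i) (x (next i)))
         (no-short-chord : ∀ i → ¬ R (x i) (x (next (next i))))
         (no-long-chord : ∀ i → ¬ R (x i) (x (next (next (next i)))))
         where

  private
    C6adj⇒R : ∀ i j → C6adj i j → R (x i) (x j)
    C6adj⇒R i j c with C6adj⇒next i j c
    ... | inj₁ refl = edge i
    ... | inj₂ refl = R-sym (edge j)

    R⇒C6adj : ∀ i j → R (x i) (x j) → C6adj i j
    R⇒C6adj i j r with C6adj? i j
    ... | yes c = c
    ... | no ¬c with ¬C6adj⇒ i j ¬c
    ...   | inj₁ refl                 = ⊥-elim (R-irrefl r)
    ...   | inj₂ (inj₁ refl)          = ⊥-elim (no-short-chord i r)
    ...   | inj₂ (inj₂ (inj₁ refl))   = ⊥-elim (no-short-chord j (R-sym r))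
    ...   | inj₂ (inj₂ (inj₂ refl))   = ⊥-elim (no-long-chord i r)

    injective : ∀ i j → x i ≡ x j → i ≡ j
    injective i j xi≡xj = C6adj-extensional i j λ k c →
      R⇒C6adj j k (subst (λ y → R y (x k)) xi≡xj (C6adj⇒R i k c))

  chordless-hexagon⇒C6 : (∀ i → Vert (x i)) → HasInducedC6 Vert R
  chordless-hexagon⇒C6 vert = x , vert , injective , λ i j → R⇒C6adj i j , C6adj⇒R i j

module GraphFacts (G : Graph n) where

  E? : ∀ u v → Dec (E G u v)
  E? u v = adj G u v Bool.≟ true

  E-sym : ∀ {u v} → E G u v → E G v u
  E-sym {u} {v} = trans (Graph.sym G v u)

  E-irrefl : ∀ {v} → ¬ E G v v
  E-irrefl {v} e with trans (≡.sym e) (irrefl G v)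
  ... | ()

  E⇒≢ : ∀ {u v} → E G u v → u ≢ v
  E⇒≢ e refl = E-irrefl e

  ⁅⁆-independent : ∀ {c} → Independent G ⁅ c ⁆
  ⁅⁆-independent {c} u v u∈ v∈ =
    E-irrefl ∘ subst (E G u) (trans (x∈⁅y⁆⇒x≡y c v∈) (≡.sym (x∈⁅y⁆⇒x≡y c u∈)))

  module _ {X : Fin n → Set} where

    reach-source : ∀ {u z} → ReachIn G X u z → X u
    reach-source (here x)     = x
    reach-source (step x _ _) = x

    reach-target : ∀ {u z} → ReachIn G X u z → X z
    reach-target (here x)     = x
    reach-target (step _ _ r) = reach-target r

    reach-trans : ∀ {u v z} → ReachIn G X u v → ReachIn G X v z → ReachIn G X u z
    reach-trans (here _)     r′ = r′
    reach-trans (step x e r) r′ = step x e (reach-trans r r′)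

    reach-sym : ∀ {u z} → ReachIn G X u z → ReachIn G X z u
    reach-sym (here x)     = here x
    reach-sym (step x e r) =
      reach-trans (reach-sym r) (step (reach-source r) (E-sym e) (here x))

  component-of : ∀ {v u} → E G v u → (R? : Decidable (ReachIn G (E G v) u)) →
                 IsComponent G v ⟦ R? ⟧
  component-of vu R? =
    (_ , ∈⟦⟧⁺ R? (here vu)) ,
    (λ y y∈ → reach-target (∈⟦⟧⁻ R? y∈)) ,
    (λ x y x∈ → (λ y∈ → reach-trans (reach-sym (∈⟦⟧⁻ R? x∈)) (∈⟦⟧⁻ R? y∈)) ,
                (λ r → ∈⟦⟧⁺ R? (reach-trans (∈⟦⟧⁻ R? x∈) r)))

  _∈ₛ_ : Fin n → Fin n × Subset n → Set
  u ∈ₛ A = AdjB′ G (inj₁ u) (inj₂ A)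

  data Opposite : VB G → VB G → Set where
    u∼A : ∀ {u A} → u ∈ₛ A → Opposite (inj₁ u) (inj₂ A)
    A∼u : ∀ {u A} → u ∈ₛ A → Opposite (inj₂ A) (inj₁ u)

  AdjB-sym : ∀ {p q} → AdjB G p q → AdjB G q p
  AdjB-sym = swap

  AdjB-irrefl : ∀ {p} → ¬ AdjB G p p
  AdjB-irrefl {inj₁ _} (inj₁ ())
  AdjB-irrefl {inj₁ _} (inj₂ ())
  AdjB-irrefl {inj₂ _} (inj₁ ())
  AdjB-irrefl {inj₂ _} (inj₂ ())

  AdjB⇒Opposite : ∀ {p q} → AdjB G p q → Opposite p q
  AdjB⇒Opposite {inj₁ _} {inj₂ _} (inj₁ u∈ₛA) = u∼A u∈ₛA
  AdjB⇒Opposite {inj₂ _} {inj₁ _} (inj₂ u∈ₛA) = A∼u u∈ₛA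
  AdjB⇒Opposite {inj₁ _} {inj₁ _} (inj₁ ())
  AdjB⇒Opposite {inj₁ _} {inj₁ _} (inj₂ ())
  AdjB⇒Opposite {inj₁ _} {inj₂ _} (inj₂ ())
  AdjB⇒Opposite {inj₂ _} {inj₁ _} (inj₁ ())
  AdjB⇒Opposite {inj₂ _} {inj₂ _} (inj₁ ())
  AdjB⇒Opposite {inj₂ _} {inj₂ _} (inj₂ ())

  module Component {v : Fin n} {C : Subset n} (comp : IsComponent G v C) where

    ⊆N : ∀ {u} → u ∈ C → E G v u
    ⊆N = proj₁ (proj₂ comp) _

    connected : ∀ {u w} → u ∈ C → w ∈ C → ReachIn G (E G v) u w
    connected u∈ = proj₁ (proj₂ (proj₂ comp) _ _ u∈)

    closed : ∀ {u w} → u ∈ C → E G u w → E G v w → w ∈ C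
    closed u∈ uw vw = proj₂ (proj₂ (proj₂ comp) _ _ u∈) (step (⊆N u∈) uw (here vw))

    neighbour : ∀ {u w} → u ∈ C → w ∈ C → u ≢ w → ∃[ y ] (y ∈ C × E G u y)
    neighbour {u} {w} u∈ w∈ u≢w with connected u∈ w∈
    ... | here _     = ⊥-elim (u≢w refl)
    ... | step _ e r = _ , closed u∈ e (reach-source r) , e

  module CSPartition {C K S : Subset n} (part : IsCSPartition G C K S) where

    covers : ∀ {x} → x ∈ C → x ∈ K ⊎ x ∈ S
    covers = proj₁ part _

    K⊆C : K ⊆ C
    K⊆C = proj₁ (proj₂ part) _

    S⊆C : S ⊆ C
    S⊆C = proj₁ (proj₂ (proj₂ part)) _

    K-clique : ∀ {x y} → x ∈ K → y ∈ K → x ≢ y → E G x y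
    K-clique = proj₁ (proj₂ (proj₂ (proj₂ (proj₂ part)))) _ _

    S-independent : Independent G S
    S-independent = proj₁ (proj₂ (proj₂ (proj₂ (proj₂ (proj₂ part)))))

    K-complete : ∀ {x y} → x ∈ K → y ∈ S → E G x y
    K-complete = proj₂ (proj₂ (proj₂ (proj₂ (proj₂ (proj₂ (proj₂ part)))))) _ _

    K-universal : ∀ {x y} → x ∈ K → y ∈ C → x ≢ y → E G x y
    K-universal x∈K y∈C x≢y with covers y∈C
    ... | inj₁ y∈K = K-clique x∈K y∈K x≢y
    ... | inj₂ y∈S = K-complete x∈K y∈S

    nonadjacent⇒∈S : ∀ {x y} → x ∈ C → y ∈ C → x ≢ y → ¬ E G x y → x ∈ S
    nonadjacent⇒∈S x∈C y∈C x≢y ¬xy with covers x∈C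
    ... | inj₁ x∈K = ⊥-elim (¬xy (K-universal x∈K y∈C x≢y))
    ... | inj₂ x∈S = x∈S

    S-neighbour⇒∈K : ∀ {x y} → x ∈ S → y ∈ C → E G x y → y ∈ K
    S-neighbour⇒∈K x∈S y∈C xy with covers y∈C
    ... | inj₁ y∈K = y∈K
    ... | inj₂ y∈S = ⊥-elim (S-independent _ _ x∈S y∈S xy)

  CSPartition-from-universal :
    ∀ {C S} → S ⊆ C → Independent G S → Nonempty S →
    (∀ {x y} → x ∈ C → x ∉ S → y ∈ C → x ≢ y → E G x y) →
    IsCSPartition G C (C ∩ ∁ S) S
  CSPartition-from-universal {C} {S} S⊆C S-indep (s , s∈S) universal =
    (λ x → covers) ,
    (λ x → K⊆C) ,
    (λ x → S⊆C) ,
    (λ x → K∌) ,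
    (λ x y x∈K y∈K → universal (K⊆C x∈K) (K∌ x∈K) (K⊆C y∈K)) ,
    S-indep ,
    maximum ,
    (λ x y x∈K y∈S → universal (K⊆C x∈K) (K∌ x∈K) (S⊆C y∈S) λ { refl → K∌ x∈K y∈S })
    where
    K⊆C : ∀ {x} → x ∈ C ∩ ∁ S → x ∈ C
    K⊆C x∈K = proj₁ (x∈p∩q⁻ C (∁ S) x∈K)

    K∌ : ∀ {x} → x ∈ C ∩ ∁ S → x ∉ S
    K∌ x∈K = x∈∁p⇒x∉p (proj₂ (x∈p∩q⁻ C (∁ S) x∈K))

    covers : ∀ {x} → x ∈ C → x ∈ C ∩ ∁ S ⊎ x ∈ S
    covers {x} x∈C with x ∈? S
    ... | yes x∈S = inj₂ x∈S
    ... | no  x∉S = inj₁ (x∈p∩q⁺ (x∈C , x∉p⇒x∈∁p x∉S))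

    maximum : ∀ T → T ⊆ C → Independent G T → ∣ T ∣ ≤ ∣ S ∣
    maximum T T⊆C T-indep with any? (λ x → x ∈? T ×-dec ¬? (x ∈? S))
    ... | no ¬outside =
      p⊆q⇒∣p∣≤∣q∣ λ {x} x∈T → decidable-stable (x ∈? S) (¬outside ∘ (x ,_) ∘ (x∈T ,_))
    ... | yes (x , x∈T , x∉S) =
      ℕ.≤-trans (subsingleton⇒∣p∣≤1 λ y∈T z∈T → trans (≡x y∈T) (≡.sym (≡x z∈T))) (x∈p⇒0<∣p∣ s∈S)
      where
      ≡x : ∀ {y} → y ∈ T → y ≡ x
      ≡x {y} y∈T with y ≟ x
      ... | yes y≡x = y≡x
      ... | no  y≢x =
        ⊥-elim (T-indep x y x∈T y∈T (universal (T⊆C x∈T) x∉S (T⊆C y∈T) (y≢x ∘ ≡.sym)))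

module ProbeDiamondFree⇒Conditions
  {G : Graph n} {N : Subset n} (N-independent : Independent G N)
  {Fl : Fin n → Fin n → Bool} (valid : ValidFill G N Fl)
  (diamond-free : ¬ InducedDiamondIn G (EFill G Fl))
  where

  open GraphFacts G

  H : Fin n → Fin n → Set
  H = EFill G Fl

  H? : ∀ u v → Dec (H u v)
  H? u v = E? u v ⊎-dec (Fl u v Bool.≟ true) ⊎-dec (Fl v u Bool.≟ true)

  H-sym : ∀ {u v} → H u v → H v u
  H-sym (inj₁ e)        = inj₁ (E-sym e)
  H-sym (inj₂ (inj₁ f)) = inj₂ (inj₂ f)
  H-sym (inj₂ (inj₂ f)) = inj₂ (inj₁ f)

  H-closes-diamond : ∀ {a b c d} → a ≢ d → H a b → H a c → H b c → H b d → H c d → H a d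
  H-closes-diamond {a} {b} {c} {d} a≢d ab ac bc bd cd with H? a d
  ... | yes ad = ad
  ... | no ¬ad = ⊥-elim (diamond-free (a , b , c , d , a≢d , ¬ad , ab , ac , bc , bd , cd))

  H⇒E : ∀ {x y} → H x y → x ∉ N → E G x y
  H⇒E (inj₁ e)        _   = e
  H⇒E (inj₂ (inj₁ f)) x∉N = ⊥-elim (x∉N (proj₁ (valid _ _ f)))
  H⇒E (inj₂ (inj₂ f)) x∉N = ⊥-elim (x∉N (proj₁ (proj₂ (valid _ _ f))))

  H-nonedge⇒∈N : ∀ {x y} → H x y → ¬ E G x y → x ∈ N
  H-nonedge⇒∈N {x} ab ¬ab with x ∈? N
  ... | yes x∈N = x∈N
  ... | no  x∉N = ⊥-elim (¬ab (H⇒E ab x∉N))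

  N-neighbour⇒∉N : ∀ {x y} → x ∈ N → E G x y → y ∉ N
  N-neighbour⇒∉N x∈N xy y∈N = N-independent _ _ x∈N y∈N xy

  reach⇒H : ∀ {w x y} → ReachIn G (E G w) x y → x ≡ y ⊎ H x y
  reach⇒H (here _) = inj₁ refl
  reach⇒H {x = x} {y} (step wx xz r) with reach⇒H r
  ... | inj₁ refl = inj₂ (inj₁ xz)
  ... | inj₂ zy with x ≟ y
  ...   | yes x≡y = inj₁ x≡y
  ...   | no  x≢y = inj₂ (H-closes-diamond x≢y (inj₁ (E-sym wx)) (inj₁ xz)
                        (inj₁ (reach-source r)) (inj₁ (reach-target r)) zy)

  component-H-clique : ∀ {w C x y} → IsComponent G w C → x ∈ C → y ∈ C → x ≢ y → H x y
  component-H-clique comp x∈C y∈C x≢y with reach⇒H (Component.connected comp x∈C y∈C)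
  ... | inj₁ x≡y = ⊥-elim (x≢y x≡y)
  ... | inj₂ xy  = xy

  outside-N-universal : ∀ {w C x y} → IsComponent G w C →
                        x ∈ C → x ∉ N → y ∈ C → x ≢ y → E G x y
  outside-N-universal comp x∈C x∉N y∈C x≢y = H⇒E (component-H-clique comp x∈C y∈C x≢y) x∉N

  lucs : LUCS G
  lucs v C comp with nonempty? (C ∩ N)
  ... | yes C∩N-nonempty =
    _ , C ∩ N , CSPartition-from-universal (proj₁ ∘ x∈p∩q⁻ C N)
                  (λ x y x∈ y∈ → N-independent x y (proj₂ (x∈p∩q⁻ C N x∈)) (proj₂ (x∈p∩q⁻ C N y∈)))
                  C∩N-nonempty
                  (λ x∈C x∉C∩N → outside-N-universal comp x∈C (x∉C∩N ∘ x∈p∩q⁺ ∘ (x∈C ,_)))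
  ... | no C∩N-empty =
    _ , ⁅ c ⁆ , CSPartition-from-universal (λ x∈⁅c⁆ → subst (_∈ C) (≡.sym (x∈⁅y⁆⇒x≡y c x∈⁅c⁆)) c∈C)
                  ⁅⁆-independent (c , x∈⁅x⁆ c)
                  (λ x∈C _ → outside-N-universal comp x∈C (C∩N-empty ∘ (_ ,_) ∘ x∈p∩q⁺ ∘ (x∈C ,_)))
    where
    c = proj₁ (proj₁ comp)
    c∈C = proj₂ (proj₁ comp)

  coP3K2-freeness : CoP3K2-free G
  coP3K2-freeness
    (a , b , c , d , e , a≢b , _ , d≢e , ¬ab , _ , ¬de , ac , ad , ae , bd , be , cd , ce) =
    N-independent a d a∈N d∈N ad
    where
    de : H d e
    de = H-closes-diamond d≢e (inj₁ (E-sym ad)) (inj₁ (E-sym cd)) (inj₁ ac) (inj₁ ae) (inj₁ ce)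
    d∈N : d ∈ N
    d∈N = H-nonedge⇒∈N de ¬de
    a∈N : a ∈ N
    a∈N = H-nonedge⇒∈N (H-closes-diamond a≢b (inj₁ ad) (inj₁ ae) de (inj₁ (E-sym bd)) (inj₁ (E-sym be)))
                       ¬ab

  InNG⇒∈N : ∀ {u} → InNG G u → u ∈ N
  InNG⇒∈N (v , u≢v , ¬uv , w , C , comp , K , S , part , u∈S , v∈S) =
    let y , y∈C , uy = neighbour (S⊆C u∈S) (S⊆C v∈S) u≢v
        yv = K-complete (S-neighbour⇒∈K u∈S y∈C uy) v∈S
    in H-nonedge⇒∈N (H-closes-diamond u≢v (inj₁ (E-sym (⊆N (S⊆C u∈S)))) (inj₁ uy) (inj₁ (⊆N y∈C))
                                     (inj₁ (⊆N (S⊆C v∈S))) (inj₁ yv))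
                    ¬uv
    where
    open Component comp
    open CSPartition part

  NG-independence : NG-independent G
  NG-independence u v u∈NG v∈NG = N-independent u v (InNG⇒∈N u∈NG) (InNG⇒∈N v∈NG)

  block-H-clique : ∀ {v C x y} → IsComponent G v C → x ∈ₛ (v , C) → y ∈ₛ (v , C) → x ≢ y → H x y
  block-H-clique comp (_ , _ , part , x∈S) (_ , _ , part′ , y∈S) =
    component-H-clique comp (CSPartition.S⊆C part x∈S) (CSPartition.S⊆C part′ y∈S)

  component-absorbs : ∀ {v C u u′ x} → IsComponent G v C → u ∈ C → u′ ∈ C → u ≢ u′ →
                      u ∈ N → x ∈ N → x ≢ u → H x u → H x u′ → x ∈ C
  component-absorbs {v} {C} {u} {u′} {x} comp u∈C u′∈C u≢u′ u∈N x∈N x≢u xu xu′ =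
    let k , k∈C , uk = neighbour u∈C u′∈C u≢u′
        k≢x : k ≢ x
        k≢x = λ { refl → N-independent u x u∈N x∈N uk }
        kx = H⇒E (H-closes-diamond k≢x (inj₁ (E-sym (⊆N k∈C))) (inj₁ (E-sym uk)) (inj₁ (⊆N u∈C))
                                   (inj₁ vx) (H-sym xu))
                 (N-neighbour⇒∉N u∈N uk)
    in closed k∈C kx vx
    where
    open Component comp
    v≢x : v ≢ x
    v≢x refl = N-independent x u x∈N u∈N (⊆N u∈C)
    vx : E G v x
    vx = H⇒E (H-closes-diamond v≢x (inj₁ (⊆N u∈C)) (inj₁ (⊆N u′∈C))
                               (component-H-clique comp u∈C u′∈C u≢u′) (H-sym xu) (H-sym xu′))
             (N-neighbour⇒∉N u∈N (E-sym (⊆N u∈C)))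

  no-chordless-hexagon :
    ∀ {u₀ u₂ u₄ v₁ C₁ v₃ C₃ v₅ C₅} → InNG G u₀ → InNG G u₄ →
    IsComponent G v₁ C₁ → IsComponent G v₃ C₃ → IsComponent G v₅ C₅ →
    u₀ ∈ₛ (v₁ , C₁) → u₂ ∈ₛ (v₁ , C₁) → u₂ ∈ₛ (v₃ , C₃) → u₄ ∈ₛ (v₃ , C₃) →
    u₄ ∈ₛ (v₅ , C₅) → u₀ ∈ₛ (v₅ , C₅) → u₀ ≢ u₂ → ¬ u₄ ∈ₛ (v₁ , C₁) → ⊥
  no-chordless-hexagon {u₀} {u₂} {u₄} u₀∈NG u₄∈NG comp₁ comp₃ comp₅
                       (K , S , part , u₀∈S) u₂∈ₛ@(_ , _ , part′ , u₂∈S′)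
                       u₂∈ₛ₃ u₄∈ₛ₃ u₄∈ₛ₅ u₀∈ₛ₅ u₀≢u₂ ¬u₄∈ₛ =
    ¬u₄∈ₛ (K , S , part , nonadjacent⇒∈S u₄∈C₁ u₀∈C₁ u₄≢u₀ (N-independent u₄ u₀ u₄∈N u₀∈N))
    where
    open CSPartition part
    u₀∈N = InNG⇒∈N u₀∈NG
    u₄∈N = InNG⇒∈N u₄∈NG
    u₀∈C₁ = S⊆C u₀∈S
    u₄≢u₀ : u₄ ≢ u₀
    u₄≢u₀ refl = ¬u₄∈ₛ (K , S , part , u₀∈S)
    u₄≢u₂ : u₄ ≢ u₂
    u₄≢u₂ refl = ¬u₄∈ₛ u₂∈ₛ
    u₄∈C₁ = component-absorbs comp₁ u₀∈C₁ (CSPartition.S⊆C part′ u₂∈S′) u₀≢u₂ u₀∈N u₄∈N u₄≢u₀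
              (block-H-clique comp₅ u₄∈ₛ₅ u₀∈ₛ₅ u₄≢u₀) (block-H-clique comp₃ u₄∈ₛ₃ u₂∈ₛ₃ u₄≢u₂)

  module _ (φ : Permutation′ n) where

    no-alternating-hexagon :
      ∀ {p₀ p₁ p₂ p₃ p₄ p₅} →
      InGB G φ p₀ → InGB G φ p₁ → InGB G φ p₂ → InGB G φ p₃ → InGB G φ p₄ → InGB G φ p₅ →
      Opposite p₀ p₁ → Opposite p₁ p₂ → Opposite p₂ p₃ →
      Opposite p₃ p₄ → Opposite p₄ p₅ → Opposite p₅ p₀ →
      p₀ ≢ p₂ → p₁ ≢ p₃ → ¬ AdjB G p₁ p₄ → ¬ AdjB G p₂ p₅ → ⊥
    no-alternating-hexagon g₀ g₁ g₂ g₃ g₄ g₅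
      (u∼A a₀₁) (A∼u a₂₁) (u∼A a₂₃) (A∼u a₄₃) (u∼A a₄₅) (A∼u a₀₅) p₀≢p₂ _ ¬p₁p₄ _ =
      no-chordless-hexagon g₀ g₄ (proj₁ g₁) (proj₁ g₃) (proj₁ g₅)
        a₀₁ a₂₁ a₂₃ a₄₃ a₄₅ a₀₅ (p₀≢p₂ ∘ cong inj₁) (¬p₁p₄ ∘ inj₂)
    no-alternating-hexagon g₀ g₁ g₂ g₃ g₄ g₅
      (A∼u a₁₀) (u∼A a₁₂) (A∼u a₃₂) (u∼A a₃₄) (A∼u a₅₄) (u∼A a₅₀) _ p₁≢p₃ _ ¬p₂p₅ =
      no-chordless-hexagon g₁ g₅ (proj₁ g₂) (proj₁ g₄) (proj₁ g₀)
        a₁₂ a₃₂ a₃₄ a₅₄ a₅₀ a₁₀ (p₁≢p₃ ∘ cong inj₁) (¬p₂p₅ ∘ inj₂)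

    GB-C6-freeness : GB-C6-free G φ
    GB-C6-freeness (f , vert , injective , adj⇔) =
      no-alternating-hexagon (vert 0F) (vert 1F) (vert 2F) (vert 3F) (vert 4F) (vert 5F)
        (opposite 0F) (opposite 1F) (opposite 2F) (opposite 3F) (opposite 4F) (opposite 5F)
        (distinct 0F) (distinct 1F) (no-long-chord 1F) (no-long-chord 2F)
      where
      opposite : ∀ i → Opposite (f i) (f (next i))
      opposite i = AdjB⇒Opposite (proj₂ (adj⇔ i (next i)) (C6adj-next i))
      distinct : ∀ i → f i ≢ f (next (next i))
      distinct i = next²-≢ i ∘ injective i (next (next i))
      no-long-chord : ∀ i → ¬ AdjB G (f i) (f (next (next (next i))))
      no-long-chord i = ¬C6adj-next³ i ∘ proj₁ (adj⇔ i (next (next (next i))))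

module Conditions⇒ProbeDiamondFree
  {G : Graph n} (φ : Permutation′ n) (lucs : LUCS G) (coP3K2-free : CoP3K2-free G)
  (NG-indep : NG-independent G) (C6-free : GB-C6-free G φ)
  where

  open GraphFacts G

  Adj₂ : Fin n → Fin n → Fin n → Set
  Adj₂ x v k = E G x v × E G x k

  Adj₂? : ∀ x v k → Dec (Adj₂ x v k)
  Adj₂? x v k = E? x v ×-dec E? x k

  CommonEdge : Fin n → Fin n → Set
  CommonEdge x y = ∃[ v ] ∃[ k ] (E G v k × Adj₂ x v k × Adj₂ y v k)

  CommonEdge₃ : Fin n → Fin n → Fin n → Set
  CommonEdge₃ x y z = ∃[ v ] ∃[ k ] (E G v k × Adj₂ x v k × Adj₂ y v k × Adj₂ z v k)

  CommonEdge? : ∀ x y → Dec (CommonEdge x y)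
  CommonEdge? x y = any? λ v → any? λ k → E? v k ×-dec Adj₂? x v k ×-dec Adj₂? y v k

  CommonEdge₃? : ∀ x y z → Dec (CommonEdge₃ x y z)
  CommonEdge₃? x y z =
    any? λ v → any? λ k → E? v k ×-dec Adj₂? x v k ×-dec Adj₂? y v k ×-dec Adj₂? z v k

  CommonEdge₃-rotate : ∀ {x y z} → CommonEdge₃ x y z → CommonEdge₃ y z x
  CommonEdge₃-rotate (v , k , vk , xvk , yvk , zvk) = v , k , vk , yvk , zvk , xvk

  Tips : Fin n → Fin n → Set
  Tips x y = x ≢ y × ¬ E G x y × CommonEdge x y

  Tips? : ∀ x y → Dec (Tips x y)
  Tips? x y = ¬? (x ≟ y) ×-dec ¬? (E? x y) ×-dec CommonEdge? x y

  Tips-sym : ∀ {x y} → Tips x y → Tips y x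
  Tips-sym (x≢y , ¬xy , v , k , vk , xvk , yvk) = x≢y ∘ ≡.sym , ¬xy ∘ E-sym , v , k , vk , yvk , xvk

  Tip : Fin n → Set
  Tip x = ∃ (Tips x)

  Tip? : ∀ x → Dec (Tip x)
  Tip? x = any? (Tips? x)

  record Block (v y z : Fin n) : Set where
    field
      C K S     : Subset n
      component : IsComponent G v C
      partition : IsCSPartition G C K S
      y∈S       : y ∈ S
      z∈S       : z ∈ S

  -- Reachability inside G[N(v)] is only decided under ¬¬, which suffices since every use of
  -- a block ends in a negative or decidable statement.
  find-block : ∀ {v y z} → y ≢ z → ¬ E G y z → Adj₂ v y z → ∃[ m ] (E G v m × Adj₂ m y z) →
               ¬ ¬ Block v y z
  find-block {v} {y} {z} y≢z ¬yz (vy , vz) (m , vm , my , mz) =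
    ¬¬-map from-reachability (¬¬-decidable (ReachIn G (E G v) y))
    where
    from-reachability : Decidable (ReachIn G (E G v) y) → Block v y z
    from-reachability R? =
      let K , S , part = lucs v ⟦ R? ⟧ (component-of vy R?)
          y∈C = ∈⟦⟧⁺ R? (here vy)
          z∈C = ∈⟦⟧⁺ R? (step vy (E-sym my) (step vm mz (here vz)))
      in record
        { component = component-of vy R?
        ; partition = part
        ; y∈S = CSPartition.nonadjacent⇒∈S part y∈C z∈C y≢z ¬yz
        ; z∈S = CSPartition.nonadjacent⇒∈S part z∈C y∈C (y≢z ∘ ≡.sym) (¬yz ∘ E-sym)
        }

  Block⇒FG : ∀ {v y z} → y ≢ z → ¬ E G y z → Block v y z → FG G y z
  Block⇒FG {v} y≢z ¬yz B = y≢z , ¬yz , v , C , component , K , S , partition , y∈S , z∈S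
    where open Block B

  Tips⇒¬¬InNG : ∀ {y z} → Tips y z → ¬ ¬ InNG G y
  Tips⇒¬¬InNG {z = z} (y≢z , ¬yz , w , k , wk , (yw , yk) , (zw , zk)) =
    ¬¬-map (λ B → z , Block⇒FG y≢z ¬yz B)
           (find-block y≢z ¬yz (E-sym yw , E-sym zw) (k , wk , E-sym yk , E-sym zk))

  Tip-independent : ∀ {x y} → Tip x → Tip y → ¬ E G x y
  Tip-independent (_ , tx) (_ , ty) xy =
    Tips⇒¬¬InNG tx λ x∈NG → Tips⇒¬¬InNG ty λ y∈NG → NG-indep _ _ x∈NG y∈NG xy

  Tip-neighbour⇒¬Tip : ∀ {x y} → E G x y → Tip y → ¬ Tip x
  Tip-neighbour⇒¬Tip xy ty tx = Tip-independent tx ty xy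

  E⁼ : Fin n → Fin n → Set
  E⁼ x y = x ≡ y ⊎ E G x y

  E⁼-sym : ∀ {x y} → E⁼ x y → E⁼ y x
  E⁼-sym (inj₁ x≡y) = inj₁ (≡.sym x≡y)
  E⁼-sym (inj₂ xy)  = inj₂ (E-sym xy)

  non-Tip-absorbs : ∀ {x y v k} → ¬ Tip x → E G v k → Adj₂ x v k → Adj₂ y v k → E⁼ x y
  non-Tip-absorbs {x} {y} ¬tx vk xvk yvk with x ≟ y | E? x y
  ... | yes x≡y | _      = inj₁ x≡y
  ... | no  _   | yes xy = inj₂ xy
  ... | no  x≢y | no ¬xy = ⊥-elim (¬tx (y , x≢y , ¬xy , _ , _ , vk , xvk , yvk))

  -- Otherwise w, z, k, b, c induce the complement of P₃ + K₂, or w is a tip adjacent to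
  -- the tip b.
  Tips-neighbour-sees-spine : ∀ {b c w k z} → b ≢ c → ¬ E G b c → E G w k →
                              Adj₂ b w k → Adj₂ c w k → Adj₂ z b c → E⁼ z w
  Tips-neighbour-sees-spine {b} {c} {w} {k} {z} b≢c ¬bc wk (bw , bk) (cw , ck) (zb , zc)
    with z ≟ w | E? z w | E? z k
  ... | yes z≡w | _      | _      = inj₁ z≡w
  ... | no _    | yes zw | _      = inj₂ zw
  ... | no z≢w  | no ¬zw | yes zk =
    ⊥-elim (Tip-independent (z , z≢w ∘ ≡.sym , ¬zw ∘ E-sym , b , k , bk , (E-sym bw , wk) , (zb , zk))
                            (c , b≢c , ¬bc , w , k , wk , (bw , bk) , (cw , ck)) (E-sym bw))
  ... | no z≢w  | no ¬zw | no ¬zk =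
    ⊥-elim (coP3K2-free (w , z , k , b , c , z≢w ∘ ≡.sym , (λ { refl → ¬zw (E-sym wk) }) , b≢c ,
                         ¬zw ∘ E-sym , ¬zk , ¬bc , wk , E-sym bw , E-sym cw , zb , zc , E-sym bk , E-sym ck))

  common-neighbours-of-Tips-clique : ∀ {b c z z′} → Tips b c → Adj₂ z b c → Adj₂ z′ b c → E⁼ z z′
  common-neighbours-of-Tips-clique t@(b≢c , ¬bc , w , k , wk , bwk@(bw , _) , cwk) zbc z′bc
    with Tips-neighbour-sees-spine b≢c ¬bc wk bwk cwk zbc
       | Tips-neighbour-sees-spine b≢c ¬bc wk bwk cwk z′bc
  ... | inj₁ refl | z′w       = E⁼-sym z′w
  ... | inj₂ zw   | inj₁ refl = inj₂ zw
  ... | inj₂ zw   | inj₂ z′w  =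
    non-Tip-absorbs (Tip-neighbour⇒¬Tip (proj₁ zbc) (_ , t)) (E-sym bw) (zw , proj₁ zbc) (z′w , proj₁ z′bc)

  Tips-neighbour-on-edge : ∀ {y z v} → Tips y z → Adj₂ v y z → ∃[ m ] (E G v m × Adj₂ m y z)
  Tips-neighbour-on-edge t@(_ , _ , w , k , wk , (yw , yk) , (zw , zk)) vyz
    with common-neighbours-of-Tips-clique t vyz (E-sym yw , E-sym zw)
  ... | inj₁ refl = k , wk , E-sym yk , E-sym zk
  ... | inj₂ vw   = w , vw , E-sym yw , E-sym zw

  rank : Fin n → ℕ
  rank x = toℕ (φ ⟨$⟩ʳ x)

  rank-injective : ∀ {x y} → rank x ≡ rank y → x ≡ y
  rank-injective eq =
    trans (≡.sym (inverseˡ φ)) (trans (cong (φ ⟨$⟩ˡ_) (toℕ-injective eq)) (inverseˡ φ))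

  record LeastBlock (y z : Fin n) : Set where
    field
      v       : Fin n
      block   : Block v y z
      minimal : ∀ {x} → Adj₂ x y z → rank v ≤ rank x
    open Block block public

    vertex : VB G
    vertex = inj₂ (v , C)

  least-block : ∀ {y z} → Tips y z → ¬ ¬ LeastBlock y z
  least-block {y} {z} t@(y≢z , ¬yz , w , _ , _ , (yw , _) , (zw , _)) =
    let v , vyz , minimal = least (λ x → Adj₂? x y z) rank (w , E-sym yw , E-sym zw)
    in ¬¬-map (λ B → record { v = v ; block = B ; minimal = minimal })
              (find-block y≢z ¬yz vyz (Tips-neighbour-on-edge t vyz))

  module _ {y z} (t : Tips y z) (B : LeastBlock y z) where
    open LeastBlock B
    open CSPartition partition

    y∈ₛ : y ∈ₛ (v , C)
    y∈ₛ = K , S , partition , y∈S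

    z∈ₛ : z ∈ₛ (v , C)
    z∈ₛ = K , S , partition , z∈S

    Tip∈GB : InGB G φ (inj₁ y)
    Tip∈GB = z , Block⇒FG (proj₁ t) (proj₁ (proj₂ t)) block

    -- Vertices of K are common neighbours of y and z, so minimality of v gives the φ-condition.
    vertex∈GB : InGB G φ vertex
    vertex∈GB =
      component , K , S , partition , x∈p∧y∈p∧x≢y⇒2≤∣p∣ y∈S z∈S (proj₁ t) ,
      λ x x∈K → ℕ.≤∧≢⇒< (minimal (K-complete x∈K y∈S , K-complete x∈K z∈S))
                         (E⇒≢ (Component.⊆N component (K⊆C x∈K)) ∘ rank-injective)

    -- A neighbour m of y in C lies in the clique part K′ of the partition that puts x in S′,
    -- so the edge v m is adjacent to x, y and z.
    chord⇒CommonEdge₃ : ∀ {x} → Tips x y → Tips x z → x ∈ₛ (v , C) → CommonEdge₃ x y z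
    chord⇒CommonEdge₃ (x≢y , ¬xy , _) (x≢z , ¬xz , _) (K′ , S′ , part′ , x∈S′) =
      let m , m∈C , ym = neighbour (S⊆C y∈S) (S⊆C z∈S) (proj₁ t)
          m∈K′ = S-neighbour⇒∈K′ y∈S′ m∈C ym
      in v , m , ⊆N m∈C , (E-sym (⊆N x∈C) , E-sym (K-complete′ m∈K′ x∈S′)) ,
         (E-sym (⊆N (S⊆C y∈S)) , ym) , (E-sym (⊆N (S⊆C z∈S)) , E-sym (K-complete′ m∈K′ z∈S′))
      where
      open Component component
      open CSPartition part′ using () renaming
        (S⊆C to S′⊆C; nonadjacent⇒∈S to nonadjacent⇒∈S′; S-neighbour⇒∈K to S-neighbour⇒∈K′;
         K-complete to K-complete′)
      x∈C = S′⊆C x∈S′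
      y∈S′ = nonadjacent⇒∈S′ (S⊆C y∈S) x∈C (x≢y ∘ ≡.sym) (¬xy ∘ E-sym)
      z∈S′ = nonadjacent⇒∈S′ (S⊆C z∈S) x∈C (x≢z ∘ ≡.sym) (¬xz ∘ E-sym)

    no-chord : ∀ {x} → Tips x y → Tips x z → ¬ CommonEdge₃ x y z → ¬ AdjB G (inj₁ x) vertex
    no-chord xy xz ¬common = [ ¬common ∘ chord⇒CommonEdge₃ xy xz , (λ ()) ]′

    no-chord′ : ∀ {x} → Tips x y → Tips x z → ¬ CommonEdge₃ x y z → ¬ AdjB G vertex (inj₁ x)
    no-chord′ xy xz ¬common = [ (λ ()) , ¬common ∘ chord⇒CommonEdge₃ xy xz ]′

  module _ {a b c} (ab : Tips a b) (bc : Tips b c) (ca : Tips c a)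
           (Bab : LeastBlock a b) (Bbc : LeastBlock b c) (Bca : LeastBlock c a)
           (¬common : ¬ CommonEdge₃ a b c) where
    open LeastBlock using (vertex)

    private
      x : Fin 6 → VB G
      x 0F = inj₁ a
      x 1F = vertex Bab
      x 2F = inj₁ b
      x 3F = vertex Bbc
      x 4F = inj₁ c
      x 5F = vertex Bca

      edge : ∀ i → AdjB G (x i) (x (next i))
      edge 0F = inj₁ (y∈ₛ ab Bab)
      edge 1F = inj₂ (z∈ₛ ab Bab)
      edge 2F = inj₁ (y∈ₛ bc Bbc)
      edge 3F = inj₂ (z∈ₛ bc Bbc)
      edge 4F = inj₁ (y∈ₛ ca Bca)
      edge 5F = inj₂ (z∈ₛ ca Bca)

      no-short-chord : ∀ i → ¬ AdjB G (x i) (x (next (next i)))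
      no-short-chord 0F = λ { (inj₁ ()) ; (inj₂ ()) }
      no-short-chord 1F = λ { (inj₁ ()) ; (inj₂ ()) }
      no-short-chord 2F = λ { (inj₁ ()) ; (inj₂ ()) }
      no-short-chord 3F = λ { (inj₁ ()) ; (inj₂ ()) }
      no-short-chord 4F = λ { (inj₁ ()) ; (inj₂ ()) }
      no-short-chord 5F = λ { (inj₁ ()) ; (inj₂ ()) }

      ¬cab : ¬ CommonEdge₃ c a b
      ¬cab = ¬common ∘ CommonEdge₃-rotate

      ¬bca : ¬ CommonEdge₃ b c a
      ¬bca = ¬cab ∘ CommonEdge₃-rotate

      no-long-chord : ∀ i → ¬ AdjB G (x i) (x (next (next (next i))))
      no-long-chord 0F = no-chord  bc Bbc ab (Tips-sym ca) ¬common
      no-long-chord 1F = no-chord′ ab Bab ca (Tips-sym bc) ¬cab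
      no-long-chord 2F = no-chord  ca Bca bc (Tips-sym ab) ¬bca
      no-long-chord 3F = no-chord′ bc Bbc ab (Tips-sym ca) ¬common
      no-long-chord 4F = no-chord  ab Bab ca (Tips-sym bc) ¬cab
      no-long-chord 5F = no-chord′ ca Bca bc (Tips-sym ab) ¬bca

      vert : ∀ i → InGB G φ (x i)
      vert 0F = Tip∈GB ab Bab
      vert 1F = vertex∈GB ab Bab
      vert 2F = Tip∈GB bc Bbc
      vert 3F = vertex∈GB bc Bbc
      vert 4F = Tip∈GB ca Bca
      vert 5F = vertex∈GB ca Bca

    Tips-triangle-hexagon : HasInducedC6 (InGB G φ) (AdjB G)
    Tips-triangle-hexagon =
      chordless-hexagon⇒C6 {Vert = InGB G φ} {R = AdjB G} AdjB-sym AdjB-irrefl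
                           x edge no-short-chord no-long-chord vert

  Tips-triangle⇒CommonEdge₃ : ∀ {a b c} → Tips a b → Tips b c → Tips c a → CommonEdge₃ a b c
  Tips-triangle⇒CommonEdge₃ {a} {b} {c} ab bc ca =
    decidable-stable (CommonEdge₃? a b c) λ ¬common →
      least-block ab λ Bab → least-block bc λ Bbc → least-block ca λ Bca →
        C6-free (Tips-triangle-hexagon ab bc ca Bab Bbc Bca ¬common)

  E⁺ : Fin n → Fin n → Set
  E⁺ x y = E G x y ⊎ Tips x y

  E⁺-sym : ∀ {x y} → E⁺ x y → E⁺ y x
  E⁺-sym (inj₁ xy) = inj₁ (E-sym xy)
  E⁺-sym (inj₂ t)  = inj₂ (Tips-sym t)

  E⁺⇒Eˡ : ∀ {x y} → E⁺ x y → ¬ Tip x → E G x y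
  E⁺⇒Eˡ (inj₁ xy) _   = xy
  E⁺⇒Eˡ (inj₂ t)  ¬tx = ⊥-elim (¬tx (_ , t))

  E⁺⇒Eʳ : ∀ {x y} → E⁺ x y → ¬ Tip y → E G x y
  E⁺⇒Eʳ xy ¬ty = E-sym (E⁺⇒Eˡ (E⁺-sym xy) ¬ty)

  E⁺⇒Tips : ∀ {x y} → E⁺ x y → Tip x → Tip y → Tips x y
  E⁺⇒Tips (inj₁ xy) tx ty = ⊥-elim (Tip-independent tx ty xy)
  E⁺⇒Tips (inj₂ t)  _  _  = t

  Close : Fin n → Fin n → Set
  Close x y = E⁼ x y ⊎ CommonEdge x y

  Close-sym : ∀ {x y} → Close x y → Close y x
  Close-sym (inj₁ xy)                        = inj₁ (E⁼-sym xy)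
  Close-sym (inj₂ (v , k , vk , xvk , yvk)) = inj₂ (v , k , vk , yvk , xvk)

  Close⇒E⁺ : ∀ {x y} → x ≢ y → Close x y → E⁺ x y
  Close⇒E⁺ x≢y (inj₁ (inj₁ x≡y)) = ⊥-elim (x≢y x≡y)
  Close⇒E⁺ x≢y (inj₁ (inj₂ xy))  = inj₁ xy
  Close⇒E⁺ {x} {y} x≢y (inj₂ common) with E? x y
  ... | yes xy  = inj₁ xy
  ... | no  ¬xy = inj₂ (x≢y , ¬xy , common)

  E⁺-neighbour-sees-common-neighbours :
    ∀ {b c y z} → Tips b c → E⁺ y b → E⁺ y c → Adj₂ z b c → ¬ Tip z → E⁼ z y
  E⁺-neighbour-sees-common-neighbours {y = y} bc yb yc zbc ¬tz with Tip? y
  ... | no ¬ty = common-neighbours-of-Tips-clique bc zbc (E⁺⇒Eˡ yb ¬ty , E⁺⇒Eˡ yc ¬ty)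
  ... | yes ty
    with Tips-triangle⇒CommonEdge₃ (E⁺⇒Tips yb ty (_ , bc)) bc (Tips-sym (E⁺⇒Tips yc ty (_ , Tips-sym bc)))
  ...   | v , k , vk , (yv , yk) , (bv , bk) , (cv , ck)
    with common-neighbours-of-Tips-clique bc zbc (E-sym bv , E-sym cv)
       | common-neighbours-of-Tips-clique bc zbc (E-sym bk , E-sym ck)
  ...     | inj₁ refl | _         = inj₂ (E-sym yv)
  ...     | inj₂ _    | inj₁ refl = inj₂ (E-sym yk)
  ...     | inj₂ zv   | inj₂ zk   = non-Tip-absorbs ¬tz vk (zv , zk) (yv , yk)

  diamond-with-Tips-edge : ∀ {a b c d} → Tips b c → E⁺ a b → E⁺ a c → E⁺ d b → E⁺ d c → Close a d
  diamond-with-Tips-edge {a} bc ab ac db dc with Tip? a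
  ... | no ¬ta = inj₁ (E⁺-neighbour-sees-common-neighbours bc db dc (E⁺⇒Eˡ ab ¬ta , E⁺⇒Eˡ ac ¬ta) ¬ta)
  ... | yes ta
    with Tips-triangle⇒CommonEdge₃ (E⁺⇒Tips ab ta (_ , bc)) bc (Tips-sym (E⁺⇒Tips ac ta (_ , Tips-sym bc)))
  ...   | v , k , vk , (av , ak) , (bv , bk) , (cv , ck)
    with E⁺-neighbour-sees-common-neighbours bc db dc (E-sym bv , E-sym cv) (Tip-neighbour⇒¬Tip (E-sym av) ta)
       | E⁺-neighbour-sees-common-neighbours bc db dc (E-sym bk , E-sym ck) (Tip-neighbour⇒¬Tip (E-sym ak) ta)
  ...     | inj₁ refl | _         = inj₁ (inj₂ av)
  ...     | inj₂ _    | inj₁ refl = inj₁ (inj₂ ak)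
  ...     | inj₂ vd   | inj₂ kd   = inj₂ (v , k , vk , (av , ak) , (E-sym vd , E-sym kd))

  diamond-Tip-to-non-Tip : ∀ {a b c d} → Tips a b → E G a c → E G b c → ¬ Tip d → E G d b → E G d c →
                           Close a d
  diamond-Tip-to-non-Tip {c = c} ab ac bc ¬td db dc with Tips-neighbour-on-edge ab (E-sym ac , E-sym bc)
  ... | m , cm , (ma , mb) with non-Tip-absorbs ¬td bc (db , dc) (mb , E-sym cm)
  ...   | inj₁ refl = inj₁ (inj₂ (E-sym ma))
  ...   | inj₂ dm   = inj₂ (c , m , cm , (ac , E-sym ma) , (dc , dm))

  diamond-Tip-to-Tip : ∀ {a b c d} → Tips a b → Tips d b → E G a c → E G b c → E G d c → Close a d
  diamond-Tip-to-Tip {c = c} ab db ac bc dc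
    with Tips-neighbour-on-edge ab (E-sym ac , E-sym bc) | Tips-neighbour-on-edge db (E-sym dc , E-sym bc)
  ... | m₁ , cm₁ , (m₁a , m₁b) | m₂ , cm₂ , (m₂d , m₂b)
    with non-Tip-absorbs (Tip-neighbour⇒¬Tip m₁a (_ , ab)) bc (m₁b , E-sym cm₁) (m₂b , E-sym cm₂)
  ...   | inj₁ refl = inj₂ (c , m₁ , cm₁ , (ac , E-sym m₁a) , (dc , E-sym m₂d))
  ...   | inj₂ m₁m₂
    with non-Tip-absorbs (Tip-neighbour⇒¬Tip m₂d (_ , db)) cm₁ (E-sym cm₂ , E-sym m₁m₂) (ac , E-sym m₁a)
  ...     | inj₁ refl = inj₁ (inj₂ m₂d)
  ...     | inj₂ m₂a  = inj₂ (c , m₂ , cm₂ , (ac , E-sym m₂a) , (dc , E-sym m₂d))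

  diamond-with-Tip-and-non-Tip : ∀ {a b c d} → Tip b → E⁺ a b → E G a c → E G b c → E⁺ d b → E G d c →
                                 Close a d
  diamond-with-Tip-and-non-Tip {a} {b} {c} {d} tb ab ac bc db dc with Tip? a | Tip? d
  ... | no ¬ta | no ¬td = inj₂ (b , c , bc , (E⁺⇒Eˡ ab ¬ta , ac) , (E⁺⇒Eˡ db ¬td , dc))
  ... | yes ta | no ¬td = diamond-Tip-to-non-Tip (E⁺⇒Tips ab ta tb) ac bc ¬td (E⁺⇒Eˡ db ¬td) dc
  ... | no ¬ta | yes td = Close-sym (diamond-Tip-to-non-Tip (E⁺⇒Tips db td tb) dc bc ¬ta (E⁺⇒Eˡ ab ¬ta) ac)
  ... | yes ta | yes td = diamond-Tip-to-Tip (E⁺⇒Tips ab ta tb) (E⁺⇒Tips db td tb) ac bc dc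

  diamond-closes : ∀ {a b c d} → E⁺ a b → E⁺ a c → E⁺ b c → E⁺ d b → E⁺ d c → Close a d
  diamond-closes {b = b} {c} ab ac bc db dc with Tip? b | Tip? c
  ... | no ¬tb | no ¬tc =
    inj₂ (b , c , E⁺⇒Eˡ bc ¬tb , (E⁺⇒Eʳ ab ¬tb , E⁺⇒Eʳ ac ¬tc) , (E⁺⇒Eʳ db ¬tb , E⁺⇒Eʳ dc ¬tc))
  ... | yes tb | yes tc = diamond-with-Tips-edge (E⁺⇒Tips bc tb tc) ab ac db dc
  ... | yes tb | no ¬tc =
    diamond-with-Tip-and-non-Tip tb ab (E⁺⇒Eʳ ac ¬tc) (E⁺⇒Eʳ bc ¬tc) db (E⁺⇒Eʳ dc ¬tc)
  ... | no ¬tb | yes tc =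
    diamond-with-Tip-and-non-Tip tc ac (E⁺⇒Eʳ ab ¬tb) (E-sym (E⁺⇒Eˡ bc ¬tb)) dc (E⁺⇒Eʳ db ¬tb)

  N : Subset n
  N = ⟦ Tip? ⟧

  Fl : Fin n → Fin n → Bool
  Fl x y = does (Tips? x y)

  N-independent : Independent G N
  N-independent x y x∈N y∈N = Tip-independent (∈⟦⟧⁻ Tip? x∈N) (∈⟦⟧⁻ Tip? y∈N)

  Fl-valid : ValidFill G N Fl
  Fl-valid x y fl =
    let t = does≡true⇒ (Tips? x y) fl
    in ∈⟦⟧⁺ Tip? (y , t) , ∈⟦⟧⁺ Tip? (x , Tips-sym t) , proj₁ t , proj₁ (proj₂ t)

  EFill⇒E⁺ : ∀ {x y} → EFill G Fl x y → E⁺ x y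
  EFill⇒E⁺ (inj₁ xy)        = inj₁ xy
  EFill⇒E⁺ (inj₂ (inj₁ fl)) = inj₂ (does≡true⇒ (Tips? _ _) fl)
  EFill⇒E⁺ (inj₂ (inj₂ fl)) = inj₂ (Tips-sym (does≡true⇒ (Tips? _ _) fl))

  E⁺⇒EFill : ∀ {x y} → E⁺ x y → EFill G Fl x y
  E⁺⇒EFill (inj₁ xy) = inj₁ xy
  E⁺⇒EFill (inj₂ t)  = inj₂ (inj₁ (dec-true (Tips? _ _) t))

  diamond-free : ¬ InducedDiamondIn G (EFill G Fl)
  diamond-free (a , b , c , d , a≢d , ¬ad , ab , ac , bc , bd , cd) =
    ¬ad (E⁺⇒EFill (Close⇒E⁺ a≢d (diamond-closes (EFill⇒E⁺ ab) (EFill⇒E⁺ ac) (EFill⇒E⁺ bc)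
                                                (E⁺-sym (EFill⇒E⁺ bd)) (E⁺-sym (EFill⇒E⁺ cd)))))

  probe-diamond-free : ProbeDiamondFree G
  probe-diamond-free = N , N-independent , Fl , Fl-valid , diamond-free

theorem3 : (n : ℕ) (G : Graph n) (φ : Permutation′ n) →
    (ProbeDiamondFree G →
      LUCS G × CoP3K2-free G × NG-independent G × GB-C6-free G φ) ×
    (LUCS G × CoP3K2-free G × NG-independent G × GB-C6-free G φ →
      ProbeDiamondFree G)
theorem3 n G φ = necessary , sufficient
  where
  necessary : ProbeDiamondFree G → LUCS G × CoP3K2-free G × NG-independent G × GB-C6-free G φ
  necessary (N , N-independent , Fl , valid , diamond-free) =
    lucs , coP3K2-freeness , NG-independence , GB-C6-freeness φ
    where open ProbeDiamondFree⇒Conditions N-independent valid diamond-free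
  sufficient : LUCS G × CoP3K2-free G × NG-independent G × GB-C6-free G φ → ProbeDiamondFree G
  sufficient (lucs , coP3K2-free , NG-indep , C6-free) =
    Conditions⇒ProbeDiamondFree.probe-diamond-free φ lucs coP3K2-free NG-indep C6-free
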